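{- Let $H$ be a (multi)graph and $k\ge1$ fixed. Let $(A(n))_{n\ge1}$ be a sequence of simply $k$-colored multicolored-$H$-free multigraphs with $|A(n)|=n$ and $e(A(n+1))-\delta(A(n+1))=e(A(n))$ for each $n$. Suppose there is $M_0>0$ such that whenever $n>M_0$ and $G$ is a $k$-color extremal multigraph of $H$ of order $n$ with $\delta(G)\ge\delta(A(n))$, we have $G=A(n)$. Then there exists $n_0=n_0(M_0,k)>0$ such that for every $n>n_0$, $A(n)$ is the unique $k$-color extremal multigraph of $H$ of order $n$.
   Context: Multigraphs are loopless; $e(\cdot)$, degrees and $\delta(\cdot)$ count multiplicity. A simply $k$-colored multigraph has its edge multiset decomposed into $k$ simple graphs (colors). $G$ contains a multicolored copy of $H$ if there is an injection $\phi:V(H)\to V(G)$ and, for each pair $xy$, $w_H(xy)$ edges between $\phi(x),\phi(y)$, all chosen edges having distinct colors; otherwise multicolored-$H$-free. A $k$-color extremal multigraph of $H$ of order $n$ is an $n$-vertex simply $k$-colored multicolored-$H$-free multigraph with the maximum possible number of edges. -}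

module Defs where

open import Data.Nat using (ℕ; zero; suc; _+_; _≤_; _<_; _⊓_; _<ᵇ_)
open import Data.Fin using (Fin; toℕ) renaming (_<_ to _<ᶠ_; zero to fzero; suc to fsuc)
open import Data.Bool using (Bool; true; false; if_then_else_)
open import Data.Product using (Σ; _×_; _,_; ∃-syntax)
open import Relation.Binary.PropositionalEquality using (_≡_)
open import Relation.Nullary using (¬_)
open import Function.Definitions using (Injective)
open import Function.Bundles using (_↔_; Inverse)

sumFin : (n : ℕ) → (Fin n → ℕ) → ℕ
sumFin zero    f = 0
sumFin (suc n) f = f fzero + sumFin n (λ i → f (fsuc i))

-- minimum over Fin n (convention: 0 for n = 0; only used for n ≥ 1)
minFin : (n : ℕ) → (Fin n → ℕ) → ℕ
minFin zero          f = 0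
minFin (suc zero)    f = f fzero
minFin (suc (suc m)) f = f fzero ⊓ minFin (suc m) (λ i → f (fsuc i))

record MultiGraph (h : ℕ) : Set where
  field
    w     : Fin h → Fin h → ℕ
    w-sym : ∀ x y → w x y ≡ w y x
    w-loopless : ∀ x → w x x ≡ 0
open MultiGraph public

-- A simply k-colored multigraph on Fin n: k simple graphs (colours) on Fin n.
-- The edge uv appears in colour c iff col c u v ≡ true.
record ColMG (k n : ℕ) : Set where
  field
    col       : Fin k → Fin n → Fin n → Bool
    col-sym   : ∀ c u v → col c u v ≡ col c v u
    col-irr   : ∀ c u → col c u u ≡ false
open ColMG public

module _ {k n : ℕ} (G : ColMG k n) where
  mult : Fin n → Fin n → ℕ
  mult u v = sumFin k (λ c → if col G c u v then 1 else 0)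

  deg : Fin n → ℕ
  deg v = sumFin n (λ u → mult u v)

  δ : ℕ
  δ = minFin n deg

  e : ℕ
  e = sumFin n (λ u → sumFin n (λ v → if (toℕ u <ᵇ toℕ v) then mult u v else 0))

-- G contains a multicolored copy of H: an injection φ and, for each pair x < y,
-- w_H(xy) colours χ x y _ i (i < w_H(xy)) such that the edge φ(x)φ(y) is present
-- in each of these colours, and all chosen colours are pairwise distinct.
HasMulticoloredCopy : {h k n : ℕ} → MultiGraph h → ColMG k n → Set
HasMulticoloredCopy {h} {k} {n} H G =
  Σ (Fin h → Fin n) λ φ → Injective _≡_ _≡_ φ ×
  Σ ((x y : Fin h) → x <ᶠ y → Fin (w H x y) → Fin k) λ χ →
    (∀ x y (p : x <ᶠ y) i → col G (χ x y p i) (φ x) (φ y) ≡ true) ×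
    (∀ x y (p : x <ᶠ y) i x' y' (p' : x' <ᶠ y') i' →
       χ x y p i ≡ χ x' y' p' i' → (x ≡ x') × (y ≡ y') × (toℕ i ≡ toℕ i'))

MulticoloredFree : {h k n : ℕ} → MultiGraph h → ColMG k n → Set
MulticoloredFree H G = ¬ HasMulticoloredCopy H G

Extremal : {h k n : ℕ} → MultiGraph h → ColMG k n → Set
Extremal {k = k} {n = n} H G =
  MulticoloredFree H G × ((G' : ColMG k n) → MulticoloredFree H G' → e G' ≤ e G)

-- Equality of simply k-colored multigraphs (up to relabelling the vertices):
-- a vertex bijection preserving every colour class.
_≅_ : {k n : ℕ} → ColMG k n → ColMG k n → Set
_≅_ {k} {n} G G' = Σ (Fin n ↔ Fin n) λ σ →
  ∀ c u v → col G c u v ≡ col G' c (Inverse.to σ u) (Inverse.to σ v)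

-- Suppose some order n > M₀ had a multicoloured-H-free graph with e(A n) + t edges, t ≥ 1.
-- An extremal graph G above it is not A n, so by the stability hypothesis δ(G) < δ(A n);
-- deleting a vertex of minimum degree then loses fewer edges than passing from A n to A (n-1)
-- does, which leaves a free graph of order n - 1 beating A (n-1) by t + 1 edges.  Iterating
-- down to order M₀ produces a surplus larger than the total number M₀²k of coloured edges
-- available there, so for n > M₀ + M₀²k no such surplus exists: A n is extremal, and every
-- extremal graph is A n, since one with δ < δ(A n) would again yield a surplus at order n - 1.
module Submission where

open import Defs
open import Data.Nat using (ℕ; zero; suc; _+_; _*_; _∸_; _≤_; _<_; _≥_; _<ᵇ_; z≤n; s≤s)
open import Data.Nat.Properties
open import Data.Fin using (Fin; toℕ; punchIn) renaming (zero to fzero; suc to fsuc)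
open import Data.Fin.Properties using (toℕ-injective; punchIn-injective)
open import Data.Bool using (Bool; true; false; if_then_else_)
open import Data.Product using (Σ; _×_; _,_; ∃-syntax; proj₁)
open import Data.Sum using (inj₁; inj₂)
open import Data.Empty using (⊥; ⊥-elim)
open import Relation.Binary.PropositionalEquality
open import Relation.Nullary using (¬_; yes; no; contradiction)
open import Relation.Nullary.Reflects using (ofʸ; ofⁿ)
open import Function.Bundles using (_↔_; Inverse)
open import Function using (_∘_)
import Algebra.Properties.CommutativeMonoid.Sum as CommutativeMonoidSum

module ∑ = CommutativeMonoidSum +-0-commutativeMonoid

sumFin≡sum : ∀ n (f : Fin n → ℕ) → sumFin n f ≡ ∑.sum f
sumFin≡sum zero    f = refl
sumFin≡sum (suc n) f = cong (f fzero +_) (sumFin≡sum n (f ∘ fsuc))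

sumFin-cong : ∀ n {f g : Fin n → ℕ} → f ≗ g → sumFin n f ≡ sumFin n g
sumFin-cong zero    f≗g = refl
sumFin-cong (suc n) f≗g = cong₂ _+_ (f≗g fzero) (sumFin-cong n (f≗g ∘ fsuc))

sumFin-mono : ∀ n {f g : Fin n → ℕ} → (∀ i → f i ≤ g i) → sumFin n f ≤ sumFin n g
sumFin-mono zero    f≤g = z≤n
sumFin-mono (suc n) f≤g = +-mono-≤ (f≤g fzero) (sumFin-mono n (f≤g ∘ fsuc))

sumFin-const : ∀ n c → sumFin n (λ _ → c) ≡ n * c
sumFin-const zero    c = refl
sumFin-const (suc n) c = cong (c +_) (sumFin-const n c)

sumFin-distrib-+ : ∀ n (f g : Fin n → ℕ) →
  sumFin n (λ i → f i + g i) ≡ sumFin n f + sumFin n g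
sumFin-distrib-+ n f g = begin
  sumFin n (λ i → f i + g i) ≡⟨ sumFin≡sum n _ ⟩
  ∑.sum (λ i → f i + g i)    ≡⟨ ∑.∑-distrib-+ f g ⟩
  ∑.sum f + ∑.sum g          ≡⟨ sym (cong₂ _+_ (sumFin≡sum n f) (sumFin≡sum n g)) ⟩
  sumFin n f + sumFin n g    ∎
  where open ≡-Reasoning

sumFin-comm : ∀ n m (f : Fin n → Fin m → ℕ) →
  sumFin n (λ i → sumFin m (f i)) ≡ sumFin m (λ j → sumFin n (λ i → f i j))
sumFin-comm zero    m f = sym (trans (sumFin-const m 0) (*-zeroʳ m))
sumFin-comm (suc n) m f = trans (cong (sumFin m (f fzero) +_) (sumFin-comm n m (f ∘ fsuc)))
                                (sym (sumFin-distrib-+ m (f fzero) _))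

sumFin-remove : ∀ n (f : Fin (suc n) → ℕ) i → sumFin (suc n) f ≡ f i + sumFin n (f ∘ punchIn i)
sumFin-remove n f i = begin
  sumFin (suc n) f                  ≡⟨ sumFin≡sum (suc n) f ⟩
  ∑.sum f                           ≡⟨ ∑.sum-remove f ⟩
  f i + ∑.sum (f ∘ punchIn i)       ≡⟨ cong (f i +_) (sym (sumFin≡sum n _)) ⟩
  f i + sumFin n (f ∘ punchIn i)    ∎
  where open ≡-Reasoning

sumFin-permute : ∀ n (f : Fin n → ℕ) (σ : Fin n ↔ Fin n) →
  sumFin n (f ∘ Inverse.to σ) ≡ sumFin n f
sumFin-permute n f σ = begin
  sumFin n (f ∘ Inverse.to σ) ≡⟨ sumFin≡sum n _ ⟩
  ∑.sum (f ∘ Inverse.to σ)    ≡⟨ sym (∑.sum-permute f σ) ⟩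
  ∑.sum f                     ≡⟨ sym (sumFin≡sum n f) ⟩
  sumFin n f                  ∎
  where open ≡-Reasoning

minFin-attained : ∀ n (f : Fin (suc n) → ℕ) → ∃[ i ] minFin (suc n) f ≡ f i
minFin-attained zero    f = fzero , refl
minFin-attained (suc n) f with ⊓-sel (f fzero) (minFin (suc n) (f ∘ fsuc))
... | inj₁ min≡f₀ = fzero , min≡f₀
... | inj₂ min≡rest with minFin-attained n (f ∘ fsuc)
...   | i , rest≡fᵢ = fsuc i , trans min≡rest rest≡fᵢ

module _ {k n : ℕ} (G : ColMG k n) where

  private
    indicator-cong : ∀ {b b′ : Bool} → b ≡ b′ → (if b then 1 else 0) ≡ (if b′ then 1 else 0)
    indicator-cong = cong (λ b → if b then 1 else 0)

  mult-sym : ∀ u v → mult G u v ≡ mult G v u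
  mult-sym u v = sumFin-cong k (λ c → indicator-cong (col-sym G c u v))

  mult-diag : ∀ u → mult G u u ≡ 0
  mult-diag u = trans (sumFin-cong k (λ c → indicator-cong (col-irr G c u)))
                      (trans (sumFin-const k 0) (*-zeroʳ k))

  mult≤k : ∀ u v → mult G u v ≤ k
  mult≤k u v = subst (mult G u v ≤_) (trans (sumFin-const k 1) (*-identityʳ k))
                     (sumFin-mono k (λ c → indicator≤1 (col G c u v)))
    where
    indicator≤1 : ∀ b → (if b then 1 else 0) ≤ 1
    indicator≤1 true  = s≤s z≤n
    indicator≤1 false = z≤n

  private
    multIf< : Fin n → Fin n → Fin n → Fin n → ℕ
    multIf< x y u v = if toℕ x <ᵇ toℕ y then mult G u v else 0

  -- Every unordered pair {u,v} is counted by exactly one of the orders, the diagonal by neither.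
  mult-split : ∀ u v → multIf< u v u v + multIf< v u u v ≡ mult G u v
  mult-split u v with toℕ u <ᵇ toℕ v | <ᵇ-reflects-< (toℕ u) (toℕ v)
                    | toℕ v <ᵇ toℕ u | <ᵇ-reflects-< (toℕ v) (toℕ u)
  ... | true  | ofʸ u<v  | true  | ofʸ v<u  = ⊥-elim (<-asym u<v v<u)
  ... | true  | _        | false | _        = +-identityʳ _
  ... | false | _        | true  | _        = refl
  ... | false | ofⁿ u≮v  | false | ofⁿ v≮u  =
    sym (trans (cong (λ x → mult G x v) u≡v) (mult-diag v))
    where
    u≡v : u ≡ v
    u≡v = toℕ-injective (≤-antisym (≮⇒≥ v≮u) (≮⇒≥ u≮v))

  handshake : 2 * e G ≡ sumFin n (deg G)
  handshake = begin
    2 * e G                                                              ≡⟨ cong (e G +_) (+-identityʳ (e G)) ⟩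
    e G + e G                                                            ≡⟨ cong (e G +_) e≡reversed ⟩
    e G + sumFin n (λ u → sumFin n (λ v → multIf< v u u v))               ≡⟨ sym (sumFin-distrib-+ n _ _) ⟩
    sumFin n (λ u → sumFin n (λ v → multIf< u v u v) + sumFin n (λ v → multIf< v u u v))
      ≡⟨ sumFin-cong n (λ u → sym (sumFin-distrib-+ n _ _)) ⟩
    sumFin n (λ u → sumFin n (λ v → multIf< u v u v + multIf< v u u v))   ≡⟨ sumFin-cong n (λ u → sumFin-cong n (mult-split u)) ⟩
    sumFin n (λ u → sumFin n (λ v → mult G u v))                          ≡⟨ sumFin-cong n (λ u → sumFin-cong n (mult-sym u)) ⟩
    sumFin n (deg G)                                                     ∎
    where
    open ≡-Reasoning
    e≡reversed : e G ≡ sumFin n (λ u → sumFin n (λ v → multIf< v u u v))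
    e≡reversed = trans (sumFin-comm n n (λ v u → multIf< v u v u))
      (sumFin-cong n (λ u → sumFin-cong n (λ v → cong (λ m → if toℕ v <ᵇ toℕ u then m else 0) (mult-sym v u))))

  e≤n²k : e G ≤ n * (n * k)
  e≤n²k = subst (e G ≤_) (trans (sumFin-cong n (λ _ → sumFin-const n k)) (sumFin-const n (n * k)))
                (sumFin-mono n (λ u → sumFin-mono n (λ v → multIf<≤k u v)))
    where
    multIf<≤k : ∀ u v → multIf< u v u v ≤ k
    multIf<≤k u v with toℕ u <ᵇ toℕ v
    ... | true  = mult≤k u v
    ... | false = z≤n

deleteVertex : ∀ {k m} → ColMG k (suc m) → Fin (suc m) → ColMG k m
deleteVertex G v = record
  { col     = λ c x y → col G c (punchIn v x) (punchIn v y)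
  ; col-sym = λ c x y → col-sym G c (punchIn v x) (punchIn v y)
  ; col-irr = λ c x → col-irr G c (punchIn v x)
  }

module _ {k m : ℕ} (G : ColMG k (suc m)) (v : Fin (suc m)) where

  private
    G-v = deleteVertex G v

  sumFin-deg-deleteVertex : sumFin (suc m) (deg G) ≡ sumFin m (deg G-v) + 2 * deg G v
  sumFin-deg-deleteVertex = begin
    sumFin (suc m) (deg G)                                          ≡⟨ sumFin-remove m (deg G) v ⟩
    deg G v + sumFin m (deg G ∘ punchIn v)                          ≡⟨ cong (deg G v +_) (sumFin-cong m deg-punchIn) ⟩
    deg G v + sumFin m (λ i → mult G v (punchIn v i) + deg G-v i)   ≡⟨ cong (deg G v +_) (sumFin-distrib-+ m _ _) ⟩
    deg G v + (sumFin m (mult G v ∘ punchIn v) + sumFin m (deg G-v)) ≡⟨ cong (λ x → deg G v + (x + sumFin m (deg G-v))) edges-at-v ⟩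
    deg G v + (deg G v + sumFin m (deg G-v))                         ≡⟨ sym (+-assoc (deg G v) _ _) ⟩
    deg G v + deg G v + sumFin m (deg G-v)                           ≡⟨ +-comm (deg G v + deg G v) _ ⟩
    sumFin m (deg G-v) + (deg G v + deg G v)                         ≡⟨ cong (λ x → sumFin m (deg G-v) + (deg G v + x)) (sym (+-identityʳ (deg G v))) ⟩
    sumFin m (deg G-v) + 2 * deg G v                                 ∎
    where
    open ≡-Reasoning
    deg-punchIn : ∀ i → deg G (punchIn v i) ≡ mult G v (punchIn v i) + deg G-v i
    deg-punchIn i = sumFin-remove m (λ u → mult G u (punchIn v i)) v
    edges-at-v : sumFin m (mult G v ∘ punchIn v) ≡ deg G v
    edges-at-v = begin
      sumFin m (mult G v ∘ punchIn v)             ≡⟨ sumFin-cong m (mult-sym G v ∘ punchIn v) ⟩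
      sumFin m (λ i → mult G (punchIn v i) v)     ≡⟨ cong (_+ sumFin m (λ i → mult G (punchIn v i) v)) (sym (mult-diag G v)) ⟩
      mult G v v + sumFin m (λ i → mult G (punchIn v i) v) ≡⟨ sym (sumFin-remove m (λ u → mult G u v) v) ⟩
      deg G v                                     ∎

  e-deleteVertex : e G ≡ e G-v + deg G v
  e-deleteVertex = *-cancelˡ-≡ _ _ 2 (begin
    2 * e G                              ≡⟨ handshake G ⟩
    sumFin (suc m) (deg G)               ≡⟨ sumFin-deg-deleteVertex ⟩
    sumFin m (deg G-v) + 2 * deg G v     ≡⟨ cong (_+ 2 * deg G v) (sym (handshake G-v)) ⟩
    2 * e G-v + 2 * deg G v              ≡⟨ sym (*-distribˡ-+ 2 (e G-v) (deg G v)) ⟩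
    2 * (e G-v + deg G v)                ∎)
    where open ≡-Reasoning

  deleteVertex-free : ∀ {h} (H : MultiGraph h) → MulticoloredFree H G → MulticoloredFree H G-v
  deleteVertex-free H free (φ , φ-inj , colours) =
    free (punchIn v ∘ φ , (λ {x} {y} eq → φ-inj (punchIn-injective v (φ x) (φ y) eq)) , colours)

minDegreeVertex : ∀ {k m} (G : ColMG k (suc m)) → ∃[ v ] δ G ≡ deg G v
minDegreeVertex {m = m} G = minFin-attained m (deg G)

e-deleteMinDegree : ∀ {k m} (G : ColMG k (suc m)) → ∃[ v ] e G ≡ e (deleteVertex G v) + δ G
e-deleteMinDegree G with minDegreeVertex G
... | v , δ≡deg = v , trans (e-deleteVertex G v) (cong (e (deleteVertex G v) +_) (sym δ≡deg))

δ≤e : ∀ {k m} (G : ColMG k (suc m)) → δ G ≤ e G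
δ≤e G with e-deleteMinDegree G
... | v , e≡ = subst (δ G ≤_) (sym e≡) (m≤n+m (δ G) _)

e-≅ : ∀ {k n} (G G′ : ColMG k n) → G ≅ G′ → e G ≡ e G′
e-≅ {k} {n} G G′ (σ , col≡) = *-cancelˡ-≡ _ _ 2 (begin
  2 * e G                            ≡⟨ handshake G ⟩
  sumFin n (deg G)                   ≡⟨ sumFin-cong n deg-transport ⟩
  sumFin n (deg G′ ∘ Inverse.to σ)   ≡⟨ sumFin-permute n (deg G′) σ ⟩
  sumFin n (deg G′)                  ≡⟨ sym (handshake G′) ⟩
  2 * e G′                           ∎)
  where
  open ≡-Reasoning
  s = Inverse.to σ
  mult-transport : ∀ u v → mult G u v ≡ mult G′ (s u) (s v)
  mult-transport u v = sumFin-cong k (λ c → cong (λ b → if b then 1 else 0) (col≡ c u v))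
  deg-transport : ∀ v → deg G v ≡ deg G′ (s v)
  deg-transport v = trans (sumFin-cong n (λ u → mult-transport u v))
                          (sumFin-permute n (λ u → mult G′ u (s v)) σ)

EdgesAtLeast : ∀ {k n} → (ColMG k n → Set) → ℕ → Set
EdgesAtLeast {k} {n} P s = Σ (ColMG k n) λ G → P G × s ≤ e G

-- Constructive substitute for the existence of an extremal graph: a graph with more edges than
-- a candidate either refutes maximality of the candidate or has less room below the bound n²k.
¬extremal-atLeast⇒¬free-atLeast : ∀ {h k n} (H : MultiGraph h) s →
  ¬ EdgesAtLeast {k} {n} (Extremal H) s → ¬ EdgesAtLeast {k} {n} (MulticoloredFree H) s
¬extremal-atLeast⇒¬free-atLeast {k = k} {n} H s noExtremal (G , free , s≤e) =
  search (n * (n * k)) G free s≤e (m≤n+m _ (e G))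
  where
  search : ∀ slack (G : ColMG k n) → MulticoloredFree H G → s ≤ e G → n * (n * k) ≤ e G + slack → ⊥
  search slack G free s≤eG bound = noExtremal (G , (free , maximal) , s≤eG)
    where
    maximal : (G′ : ColMG k n) → MulticoloredFree H G′ → e G′ ≤ e G
    maximal G′ free′ = ≮⇒≥ (beats slack bound)
      where
      beats : ∀ slack → n * (n * k) ≤ e G + slack → ¬ e G < e G′
      beats zero         bound eG<eG′ =
        <⇒≱ eG<eG′ (≤-trans (e≤n²k G′) (subst (_ ≤_) (+-identityʳ (e G)) bound))
      beats (suc slack′) bound eG<eG′ =
        search slack′ G′ free′ (≤-trans s≤eG (<⇒≤ eG<eG′))
               (≤-trans bound (subst (_≤ e G′ + slack′) (sym (+-suc (e G) slack′)) (+-monoˡ-≤ slack′ eG<eG′)))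

module Stability (k M₀ : ℕ) (0<M₀ : 0 < M₀) {h : ℕ} (H : MultiGraph h) (A : (n : ℕ) → ColMG k n)
  (A-free : ∀ n → 1 ≤ n → MulticoloredFree H (A n))
  (A-edges : ∀ n → 1 ≤ n → e (A (n + 1)) ∸ δ (A (n + 1)) ≡ e (A n))
  (A-stable : ∀ n → M₀ < n → (G : ColMG k n) → Extremal H G → δ G ≥ δ (A n) → G ≅ A n) where

  Surplus : ℕ → ℕ → Set
  Surplus n t = EdgesAtLeast {k} {n} (MulticoloredFree H) (e (A n) + t)

  M₀<1+m⇒1≤m : ∀ {m} → M₀ < suc m → 1 ≤ m
  M₀<1+m⇒1≤m M₀<1+m = ≤-trans 0<M₀ (≤-pred M₀<1+m)

  e-A-suc : ∀ m → 1 ≤ m → e (A (suc m)) ≡ e (A m) + δ (A (suc m))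
  e-A-suc m 1≤m = begin
    e (A (suc m))                                  ≡⟨ sym (m∸n+n≡m (δ≤e (A (suc m)))) ⟩
    e (A (suc m)) ∸ δ (A (suc m)) + δ (A (suc m))  ≡⟨ cong (_+ δ (A (suc m))) A-edges′ ⟩
    e (A m) + δ (A (suc m))                        ∎
    where
    open ≡-Reasoning
    A-edges′ : e (A (suc m)) ∸ δ (A (suc m)) ≡ e (A m)
    A-edges′ = subst (λ n → e (A n) ∸ δ (A n) ≡ e (A m)) (+-comm m 1) (A-edges m 1≤m)

  lowDegree⇒surplus : ∀ m t → 1 ≤ m → (G : ColMG k (suc m)) → MulticoloredFree H G →
    δ G < δ (A (suc m)) → e (A (suc m)) + t ≤ e G → Surplus m (suc t)
  lowDegree⇒surplus m t 1≤m G free δG<δA eA+t≤eG with e-deleteMinDegree G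
  ... | v , eG≡ = deleteVertex G v , deleteVertex-free G v H free , +-cancelʳ-≤ (δ G) _ _ (begin
    e (A m) + suc t + δ G        ≡⟨ cong (_+ δ G) (+-suc (e (A m)) t) ⟩
    suc (e (A m) + t + δ G)      ≡⟨ cong suc (+-assoc (e (A m)) t (δ G)) ⟩
    suc (e (A m) + (t + δ G))    ≡⟨ cong (λ x → suc (e (A m) + x)) (+-comm t (δ G)) ⟩
    suc (e (A m) + (δ G + t))    ≡⟨ sym (+-suc (e (A m)) (δ G + t)) ⟩
    e (A m) + (suc (δ G) + t)    ≤⟨ +-monoʳ-≤ (e (A m)) (+-monoˡ-≤ t δG<δA) ⟩
    e (A m) + (δ (A (suc m)) + t) ≡⟨ sym (+-assoc (e (A m)) _ t) ⟩
    e (A m) + δ (A (suc m)) + t  ≡⟨ cong (_+ t) (sym (e-A-suc m 1≤m)) ⟩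
    e (A (suc m)) + t            ≤⟨ eA+t≤eG ⟩
    e G                          ≡⟨ eG≡ ⟩
    e (deleteVertex G v) + δ G   ∎)
    where open ≤-Reasoning

  extremal⇒≅A : ∀ m t → M₀ < suc m → ¬ Surplus m (suc t) →
    (G : ColMG k (suc m)) → Extremal H G → e (A (suc m)) + t ≤ e G → G ≅ A (suc m)
  extremal⇒≅A m t M₀<1+m noSurplus G extremal eA+t≤eG with δ (A (suc m)) ≤? δ G
  ... | yes δA≤δG = A-stable (suc m) M₀<1+m G extremal δA≤δG
  ... | no  δA≰δG = contradiction
    (lowDegree⇒surplus m t (M₀<1+m⇒1≤m M₀<1+m) G (proj₁ extremal) (≰⇒> δA≰δG) eA+t≤eG) noSurplus

  ¬surplus-suc : ∀ m t → M₀ < suc m → 1 ≤ t → ¬ Surplus m (suc t) → ¬ Surplus (suc m) t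
  ¬surplus-suc m t M₀<1+m 1≤t noSurplus =
    ¬extremal-atLeast⇒¬free-atLeast H _ λ (G , extremal , eA+t≤eG) →
      <⇒≱ (m<m+n (e (A (suc m))) 1≤t)
          (≤-trans eA+t≤eG (≤-reflexive (e-≅ G (A (suc m)) (extremal⇒≅A m t M₀<1+m noSurplus G extremal eA+t≤eG))))

  B : ℕ
  B = M₀ * (M₀ * k)

  ¬surplus-M₀ : ∀ t → B < t → ¬ Surplus M₀ t
  ¬surplus-M₀ t B<t (G , _ , eA+t≤eG) = <⇒≱ B<t (≤-trans (m≤n+m t _) (≤-trans eA+t≤eG (e≤n²k G)))

  ¬surplus : ∀ d t → 1 ≤ t → B < t + d → ¬ Surplus (d + M₀) t
  ¬surplus zero    t 1≤t B<t+0 = ¬surplus-M₀ t (subst (B <_) (+-identityʳ t) B<t+0)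
  ¬surplus (suc d) t 1≤t B<t+1+d =
    ¬surplus-suc (d + M₀) t (s≤s (m≤n+m M₀ d)) 1≤t
      (¬surplus d (suc t) (s≤s z≤n) (subst (B <_) (+-suc t d) B<t+1+d))

  ¬surplus-one : ∀ n → M₀ + B ≤ n → ¬ Surplus n 1
  ¬surplus-one n M₀+B≤n = subst (λ n → ¬ Surplus n 1) (m∸n+n≡m M₀≤n)
    (¬surplus (n ∸ M₀) 1 (s≤s z≤n) (s≤s (+-cancelˡ-≤ M₀ B _ (≤-trans M₀+B≤n (m≤n+m∸n n M₀)))))
    where
    M₀≤n : M₀ ≤ n
    M₀≤n = ≤-trans (m≤m+n M₀ B) M₀+B≤n

  A-extremal : ∀ n → M₀ + B < n → Extremal H (A n)
  A-extremal n M₀+B<n = A-free n (≤-trans (s≤s z≤n) M₀+B<n) , λ G free →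
    ≮⇒≥ λ eA<eG → ¬surplus-one n (<⇒≤ M₀+B<n) (G , free , subst (_≤ e G) (+-comm 1 (e (A n))) eA<eG)

  extremal-unique : ∀ m → M₀ + B ≤ m → (G : ColMG k (suc m)) → Extremal H G → G ≅ A (suc m)
  extremal-unique m M₀+B≤m G (free , maximal) =
    extremal⇒≅A m 0 (s≤s (≤-trans (m≤m+n M₀ B) M₀+B≤m)) (¬surplus-one m M₀+B≤m) G (free , maximal)
      (subst (_≤ e G) (sym (+-identityʳ _)) (maximal (A (suc m)) (A-free (suc m) (s≤s z≤n))))

  A-unique-extremal : ∀ n → M₀ + B < n → Extremal H (A n) × ((G : ColMG k n) → Extremal H G → G ≅ A n)
  A-unique-extremal (suc m) M₀+B<1+m = A-extremal (suc m) M₀+B<1+m , extremal-unique m (≤-pred M₀+B<1+m)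

propositionA2 : (k M₀ : ℕ) → 1 ≤ k → 0 < M₀ →
    ∃[ n₀ ] (0 < n₀ ×
      ({h : ℕ} (H : MultiGraph h) (A : (n : ℕ) → ColMG k n) →
        (∀ n → 1 ≤ n → MulticoloredFree H (A n)) →
        (∀ n → 1 ≤ n → e (A (n + 1)) ∸ δ (A (n + 1)) ≡ e (A n)) →
        (∀ n → M₀ < n → (G : ColMG k n) → Extremal H G → δ G ≥ δ (A n) → G ≅ A n) →
        ∀ n → n₀ < n → Extremal H (A n) × ((G : ColMG k n) → Extremal H G → G ≅ A n)))
propositionA2 k M₀ _ 0<M₀ = M₀ + M₀ * (M₀ * k) , ≤-trans 0<M₀ (m≤m+n M₀ _) ,
  λ H A A-free A-edges A-stable → Stability.A-unique-extremal k M₀ 0<M₀ H A A-free A-edges A-stable
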